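{- Let $T\ge1$ and let $\Pi=(\lambda^0,\lambda^1,\dots,\lambda^T,\lambda^{T+1})$ with $\lambda^0=\lambda^{T+1}=\emptyset$ be an interlacing sequence with profile $A=(A_0,\dots,A_T)$, where $A_0=0$ and $A_T=1$ (a skew plane partition). Then $\Phi_\Pi(t)=A_\Pi(t)$.
   Context: Partitions are finite weakly decreasing sequences of positive integers; $\lambda_k$ is the $k$-th part ($0$ if $k>\ell(\lambda)$); $m_r(\lambda)$ is the number of parts equal to $r$. For $\mu\subseteq\lambda$, $\lambda/\mu$ is a horizontal strip if $\lambda_1\ge\mu_1\ge\lambda_2\ge\mu_2\ge\cdots$; then $\theta=\lambda/\mu$ has $\theta'_r\in\{0,1\}$ cells in column $r$. Let $I_{\lambda/\mu}=\{r\ge1:\theta'_r=1,\theta'_{r+1}=0\}$, $J_{\lambda/\mu}=\{r\ge1:\theta'_r=0,\theta'_{r+1}=1\}$, $\varphi_{\lambda/\mu}(t)=\prod_{r\in I_{\lambda/\mu}}(1-t^{m_r(\lambda)})$, $\psi_{\lambda/\mu}(t)=\prod_{r\in J_{\lambda/\mu}}(1-t^{m_r(\mu)})$. A sequence $(\lambda^0,\dots,\lambda^N)$ is interlacing with profile $(A_0,\dots,A_{N-1})\in\{0,1\}^N$ if $A_i=0$ implies $\lambda^{i+1}/\lambda^i$ is a horizontal strip and $A_i=1$ implies $\lambda^i/\lambda^{i+1}$ is a horizontal strip. Then $\Phi(t)=\prod_{i=0}^{N-1}\phi_i(t)$ with $\phi_i=\varphi_{\lambda^{i+1}/\lambda^i}$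 if $A_i=0$ and $\phi_i=\psi_{\lambda^i/\lambda^{i+1}}$ if $A_i=1$. Diagram: boxes $(i,k)$, $0\le i\le N$, $1\le k\le\ell(\lambda^i)$, filled with $\lambda^i_k$; boxes $(i,k)$ and $(i+1,k')$ are adjacent iff either $A_i=0$ and $k'\in\{k,k+1\}$, or $A_i=1$ and $k'\in\{k-1,k\}$ (no other adjacencies). A connected component is a maximal set of equally filled boxes connected under adjacency; for a box $(i,k)$ in component $C$ its level is the smallest positive $h$ with $(i,k+h)\notin C$; a border component is a maximal subset of a connected component that is connected under adjacency and whose boxes all have the same level (its level). $A(t)=\prod_\beta(1-t^{\mathrm{level}(\beta)})$ over all border components $\beta$. -}

module Defs where

open import Data.Bool using (Bool; true; false; if_then_else_; _∧_)
open import Data.Nat as ℕ using (ℕ; zero; suc; _≤_; _<_; _<?_; _≤?_; _≟_)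
open import Data.Integer as ℤ using (ℤ; 0ℤ; 1ℤ)
open import Data.List using (List; []; _∷_; length; filter; map; foldr; upTo; allFin; replicate; _++_)
open import Data.List.Relation.Unary.All using (All)
open import Data.List.Relation.Unary.Any using (Any)
open import Data.List.Relation.Unary.AllPairs using (AllPairs)
open import Data.List.Relation.Unary.Linked using (Linked)
open import Data.Fin using (Fin; inject₁) renaming (suc to fsuc)
open import Data.Vec using (Vec; lookup)
open import Data.Product using (_×_; _,_; ∃; Σ)
open import Data.Sum using (_⊎_)
open import Relation.Nullary using (¬_)
open import Relation.Nullary.Decidable using (⌊_⌋; _×-dec_)
open import Relation.Binary.PropositionalEquality using (_≡_)
open import Relation.Binary.Construct.Closure.ReflexiveTransitive using (Star)

-- Polynomials in t with integer coefficients, as coefficient lists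
-- (constant term first).  Equality is coefficientwise.

Poly : Set
Poly = List ℤ

coeff : Poly → ℕ → ℤ
coeff []       _       = 0ℤ
coeff (a ∷ p)  zero    = a
coeff (a ∷ p)  (suc n) = coeff p n

_+ₚ_ : Poly → Poly → Poly
[]      +ₚ q       = q
(a ∷ p) +ₚ []      = a ∷ p
(a ∷ p) +ₚ (b ∷ q) = (a ℤ.+ b) ∷ (p +ₚ q)

-ₚ_ : Poly → Poly
-ₚ p = map ℤ.-_ p

_*ₚ_ : Poly → Poly → Poly
[]      *ₚ q = []
(a ∷ p) *ₚ q = map (a ℤ.*_) q +ₚ (0ℤ ∷ (p *ₚ q))

oneₚ : Poly
oneₚ = 1ℤ ∷ []

monomial : ℕ → Poly
monomial m = replicate m 0ℤ ++ (1ℤ ∷ [])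

oneMinusTPow : ℕ → Poly
oneMinusTPow m = oneₚ +ₚ (-ₚ monomial m)

prodₚ : List Poly → Poly
prodₚ = foldr _*ₚ_ oneₚ

infix 4 _≈ₚ_
_≈ₚ_ : Poly → Poly → Set
p ≈ₚ q = ∀ n → coeff p n ≡ coeff q n

IsPartition : List ℕ → Set
IsPartition l = Linked (λ a b → b ≤ a) l × All (λ a → 1 ≤ a) l

-- part l k = λ_k (1-indexed; 0 for k > ℓ(λ); also 0 for k = 0, never used)
part : List ℕ → ℕ → ℕ
part []       _             = 0
part (x ∷ xs) zero          = 0
part (x ∷ xs) (suc zero)    = x
part (x ∷ xs) (suc (suc k)) = part xs (suc k)

mult : ℕ → List ℕ → ℕ
mult r l = length (filter (λ a → r ≟ a) l)

HStrip : List ℕ → List ℕ → Set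
HStrip l m = ∀ k → part m (suc k) ≤ part l (suc k) × part l (suc (suc k)) ≤ part m (suc k)

-- θ'_r for θ = λ/μ : number of cells (k, r) with μ_k < r ≤ λ_k
colCount : List ℕ → List ℕ → ℕ → ℕ
colCount l m r =
  length (filter (λ k → (part m (suc k) <? r) ×-dec (r ≤? part l (suc k))) (upTo (length l)))

-- 1, 2, …, λ_1 : every element of I_{λ/μ} and J_{λ/μ} lies in this range
range1 : List ℕ → List ℕ
range1 l = map suc (upTo (part l 1))

varphi : List ℕ → List ℕ → Poly
varphi l m = prodₚ (map f (range1 l))
  where
  f : ℕ → Poly
  f r = if ⌊ colCount l m r ≟ 1 ⌋ ∧ ⌊ colCount l m (suc r) ≟ 0 ⌋
        then oneMinusTPow (mult r l) else oneₚ

psi : List ℕ → List ℕ → Poly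
psi l m = prodₚ (map f (range1 l))
  where
  f : ℕ → Poly
  f r = if ⌊ colCount l m r ≟ 0 ⌋ ∧ ⌊ colCount l m (suc r) ≟ 1 ⌋
        then oneMinusTPow (mult r m) else oneₚ

data Bit : Set where
  𝟎 𝟏 : Bit

module Seq {N : ℕ} (ls : Vec (List ℕ) (suc N)) (A : Vec Bit N) where

  lam : Fin (suc N) → List ℕ
  lam i = lookup ls i

  Interlacing : Set
  Interlacing =
    (∀ i → IsPartition (lam i)) ×
    (∀ (j : Fin N) → (lookup A j ≡ 𝟎 → HStrip (lam (fsuc j)) (lam (inject₁ j)))
                   × (lookup A j ≡ 𝟏 → HStrip (lam (inject₁ j)) (lam (fsuc j))))

  phiAt : Fin N → Poly
  phiAt j with lookup A j
  ... | 𝟎 = varphi (lam (fsuc j)) (lam (inject₁ j))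
  ... | 𝟏 = psi (lam (inject₁ j)) (lam (fsuc j))

  Φ : Poly
  Φ = prodₚ (map phiAt (allFin N))

  -- The diagram.  A position is (i , k); it is a box iff 1 ≤ k ≤ ℓ(λ^i).

  Pos : Set
  Pos = Fin (suc N) × ℕ

  IsBox : Pos → Set
  IsBox (i , k) = 1 ≤ k × k ≤ length (lam i)

  fill : Pos → ℕ
  fill (i , k) = part (lam i) k

  AdjDir : Pos → Pos → Set
  AdjDir (i , k) (i' , k') =
    Σ (Fin N) λ j → i ≡ inject₁ j × i' ≡ fsuc j ×
      ((lookup A j ≡ 𝟎 × (k' ≡ k ⊎ k' ≡ suc k)) ⊎
       (lookup A j ≡ 𝟏 × (suc k' ≡ k ⊎ k' ≡ k)))

  Adjacent : Pos → Pos → Set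
  Adjacent b b' = IsBox b × IsBox b' × (AdjDir b b' ⊎ AdjDir b' b)

  CompEdge : Pos → Pos → Set
  CompEdge b b' = Adjacent b b' × fill b ≡ fill b'

  InComp : Pos → Pos → Set
  InComp b b' = IsBox b × IsBox b' × Star CompEdge b b'

  Level : Pos → ℕ → Set
  Level (i , k) h =
    1 ≤ h × ¬ InComp (i , k) (i , k ℕ.+ h) ×
    (∀ h' → 1 ≤ h' → h' < h → InComp (i , k) (i , k ℕ.+ h'))

  BorderEdge : Pos → Pos → Set
  BorderEdge b b' = CompEdge b b' × ∃ λ h → Level b h × Level b' h

  SameBorder : Pos → Pos → Set
  SameBorder = Star BorderEdge

  -- A list of representatives (box, level) containing exactly one box of
  -- each border component.
  Rep : Set
  Rep = Pos × ℕ

  IsBorderTransversal : List Rep → Set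
  IsBorderTransversal reps =
    All (λ { (b , h) → IsBox b × Level b h }) reps ×
    (∀ b → IsBox b → Any (λ { (r , _) → SameBorder r b }) reps) ×
    AllPairs (λ { (r , _) (r' , _) → ¬ SameBorder r r' }) reps

  Aₜ : List Rep → Poly
  Aₜ reps = prodₚ (map (λ { (_ , h) → oneMinusTPow h }) reps)

module Submission where

-- Both sides are matched
-- factor by factor with the set of rises: pairs (j, r) with r ≥ 1 and
-- m_r(λʲ⁺¹) = m_r(λʲ) + 1, each weighted by 1 − t^{m_r(λʲ⁺¹)}.
--
--  * Polynomial products form a commutative monoid up to coefficientwise
--    equality, so a product is invariant under permuting its factors.
--  * Conjugate partitions: for a horizontal strip λ/μ, θ'_r = λ'_r − μ'_r ∈ {0,1},
--    and λ'_r = m_r(λ) + λ'_{r+1}; hence r ∈ I_{λ/μ} ⇔ m_r(λ) = m_r(μ) + 1 and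
--    r ∈ J_{λ/μ} ⇔ m_r(μ) = m_r(λ) + 1.  So φⱼ is the product over the rises at step j.
--  * The diagram: in column i the boxes filled with r form the band of rows
--    λ'_{r+1} < k ≤ λ'_r, lying in one component, and a box (i, k) of it has
--    level h with k + h = λ'_r + 1.  A border component of fill r and level h
--    is traced back to its first column j + 1, where m_r(λʲ) < h; there it
--    starts a rise (j, r) with h = m_r(λʲ⁺¹).  The key (j, r, h) determines the
--    border component and every rise arises, so the keys of any border
--    transversal are a permutation of the rises, which gives Φ = A.

open import Defs
open import Algebra.Structures using (IsCommutativeMonoid)
open import Data.Bool using (true; false; _∧_; if_then_else_)
open import Data.Empty using (⊥-elim)
open import Data.Fin using (Fin; zero; fromℕ; toℕ; inject₁) renaming (suc to fsuc)
import Data.Fin.Properties as FinP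
open import Data.Integer as ℤ using (0ℤ; 1ℤ)
import Data.Integer.Properties as ℤP
open import Algebra.Properties.CommutativeSemigroup ℤP.+-commutativeSemigroup
  using (interchange; x∙yz≈y∙xz)
open import Data.List using (List; []; _∷_; length; map; filter; concat; _++_; allFin; applyUpTo)
open import Data.List.Properties using (filter-accept; filter-reject; map-∘; concat-map)
open import Data.List.Membership.Propositional using (_∈_; find)
open import Data.List.Membership.Propositional.Properties
  using (∈-map⁺; ∈-map⁻; ∈-upTo⁺; ∈-filter⁺; ∈-filter⁻; ∈-concat⁺′; ∈-concat⁻′; ∈-allFin)
open import Data.List.Membership.Propositional.Properties.WithK using (unique∧set⇒bag)
open import Data.List.Relation.Binary.BagAndSetEquality using (∼bag⇒↭)
open import Data.List.Relation.Binary.Disjoint.Propositional using (Disjoint)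
open import Data.List.Relation.Binary.Permutation.Propositional using (_↭_; ↭-sym; ↭⇒↭ₛ′)
open import Data.List.Relation.Binary.Permutation.Propositional.Properties using () renaming (map⁺ to ↭-map⁺)
import Data.List.Relation.Binary.Permutation.Setoid.Properties as PermSetoid
open import Data.List.Relation.Unary.All as All using (All; []; _∷_)
import Data.List.Relation.Unary.All.Properties as All
open import Data.List.Relation.Unary.AllPairs as AllPairs using (AllPairs; []; _∷_)
import Data.List.Relation.Unary.AllPairs.Properties as AllPairs
open import Data.List.Relation.Unary.Linked using (Linked; []; [-]; _∷_)
open import Data.List.Relation.Unary.Unique.Propositional using (Unique)
import Data.List.Relation.Unary.Unique.Propositional.Properties as Unique
open import Data.Nat using (ℕ; zero; suc; _+_; _∸_; _≤_; _<_; _≤?_; _≟_; z≤n; s≤s)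
open import Data.Nat.Properties as ℕP
  using (≤-refl; ≤-trans; ≤-reflexive; <-irrefl; +-suc; +-comm; +-assoc; +-identityʳ)
open import Data.Product using (_×_; _,_; proj₁; proj₂; Σ)
open import Data.Sum using (_⊎_; inj₁; inj₂; swap)
open import Data.Vec using (Vec; lookup; []; _∷_)
open import Function using (_∘_)
open import Function.Bundles using (mk⇔)
open import Relation.Binary.Bundles using (Setoid)
open import Relation.Binary.Construct.Closure.ReflexiveTransitive using (Star; ε; _◅_; _◅◅_; reverse)
open import Relation.Binary.Definitions using (tri<; tri≈; tri>)
open import Relation.Binary.PropositionalEquality
import Relation.Binary.Reasoning.Setoid as SetoidReasoning
open import Relation.Binary.Structures using (IsEquivalence)
open import Relation.Nullary using (¬_; Dec; yes; no)
open import Relation.Nullary.Decidable using (⌊_⌋; isYes≗does; dec-true; dec-false)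
open import Relation.Unary using (Pred; Decidable)

module ProductAlgebra where

  open ≡-Reasoning

  -- Coefficientwise equality, wrapped in a record so that the two
  -- polynomials can be inferred from an equality proof.
  infix 4 _≋_
  record _≋_ (p q : Poly) : Set where
    constructor mk
    field get : p ≈ₚ q
  open _≋_ public

  ≋-refl : ∀ {p} → p ≋ p
  ≋-refl = mk λ _ → refl

  ≋-sym : ∀ {p q} → p ≋ q → q ≋ p
  ≋-sym (mk e) = mk λ n → sym (e n)

  ≋-trans : ∀ {p q r} → p ≋ q → q ≋ r → p ≋ r
  ≋-trans (mk e) (mk f) = mk λ n → trans (e n) (f n)

  ≋-isEquivalence : IsEquivalence _≋_
  ≋-isEquivalence = record { refl = ≋-refl ; sym = ≋-sym ; trans = ≋-trans }

  ≋-setoid : Setoid _ _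
  ≋-setoid = record { isEquivalence = ≋-isEquivalence }

  ≡⇒≋ : ∀ {p q} → p ≡ q → p ≋ q
  ≡⇒≋ refl = ≋-refl

  shift : Poly → Poly
  shift p = 0ℤ ∷ p

  coeff-+ : ∀ p q n → coeff (p +ₚ q) n ≡ coeff p n ℤ.+ coeff q n
  coeff-+ []      q       n       = sym (ℤP.+-identityˡ _)
  coeff-+ (a ∷ p) []      n       = sym (ℤP.+-identityʳ _)
  coeff-+ (a ∷ p) (b ∷ q) zero    = refl
  coeff-+ (a ∷ p) (b ∷ q) (suc n) = coeff-+ p q n

  coeff-scale : ∀ a q n → coeff (map (a ℤ.*_) q) n ≡ a ℤ.* coeff q n
  coeff-scale a []      n       = sym (ℤP.*-zeroʳ a)
  coeff-scale a (b ∷ q) zero    = refl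
  coeff-scale a (b ∷ q) (suc n) = coeff-scale a q n

  coeff-shift-[] : ∀ n → coeff (shift []) n ≡ 0ℤ
  coeff-shift-[] zero    = refl
  coeff-shift-[] (suc n) = refl

  coeff-∷* : ∀ a p q n →
    coeff ((a ∷ p) *ₚ q) n ≡ a ℤ.* coeff q n ℤ.+ coeff (shift (p *ₚ q)) n
  coeff-∷* a p q n =
    trans (coeff-+ (map (a ℤ.*_) q) (shift (p *ₚ q)) n)
          (cong (ℤ._+ coeff (shift (p *ₚ q)) n) (coeff-scale a q n))

  +-cong : ∀ {p p' q q'} → p ≋ p' → q ≋ q' → (p +ₚ q) ≋ (p' +ₚ q')
  +-cong {p} {p'} {q} {q'} (mk e) (mk f) = mk λ n →
    trans (coeff-+ p q n) (trans (cong₂ ℤ._+_ (e n) (f n)) (sym (coeff-+ p' q' n)))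

  shift-cong : ∀ {p q} → p ≋ q → shift p ≋ shift q
  shift-cong (mk e) = mk λ { zero → refl ; (suc n) → e n }

  drop-∷ : ∀ {a b p q} → (a ∷ p) ≋ (b ∷ q) → p ≋ q
  drop-∷ (mk e) = mk λ n → e (suc n)

  drop-∷ʳ : ∀ {b q} → [] ≋ (b ∷ q) → [] ≋ q
  drop-∷ʳ (mk e) = mk λ n → e (suc n)

  *-zeroʳ : ∀ q → (q *ₚ []) ≋ []
  *-zeroʳ []      = ≋-refl
  *-zeroʳ (a ∷ q) = mk λ { zero → refl ; (suc n) → get (*-zeroʳ q) n }

  zero-*ˡ : ∀ {p} q → [] ≋ p → [] ≋ (p *ₚ q)
  zero-*ˡ {[]}    q e = ≋-refl
  zero-*ˡ {a ∷ p} q e = mk λ n → begin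
    0ℤ                                         ≡⟨ sym (ℤP.+-identityˡ 0ℤ) ⟩
    0ℤ ℤ.+ 0ℤ                                  ≡⟨ cong₂ ℤ._+_ (head-term n) (tail-term n) ⟩
    a ℤ.* coeff q n ℤ.+ coeff (shift (p *ₚ q)) n ≡⟨ sym (coeff-∷* a p q n) ⟩
    coeff ((a ∷ p) *ₚ q) n                     ∎
    where
    head-term : ∀ n → 0ℤ ≡ a ℤ.* coeff q n
    head-term n = sym (trans (cong (ℤ._* coeff q n) (sym (get e 0))) (ℤP.*-zeroˡ (coeff q n)))
    tail-term : ∀ n → 0ℤ ≡ coeff (shift (p *ₚ q)) n
    tail-term n = sym (trans (get (shift-cong (≋-sym (zero-*ˡ q (drop-∷ʳ e)))) n) (coeff-shift-[] n))

  *-congʳ : ∀ {p p'} q → p ≋ p' → (p *ₚ q) ≋ (p' *ₚ q)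
  *-congʳ {[]}    {p'}     q e = zero-*ˡ q e
  *-congʳ {a ∷ p} {[]}     q e = ≋-sym (zero-*ˡ q (≋-sym e))
  *-congʳ {a ∷ p} {a' ∷ p'} q e = mk λ n → begin
    coeff ((a ∷ p) *ₚ q) n                        ≡⟨ coeff-∷* a p q n ⟩
    a ℤ.* coeff q n ℤ.+ coeff (shift (p *ₚ q)) n
      ≡⟨ cong₂ ℤ._+_ (cong (ℤ._* coeff q n) (get e 0))
                     (get (shift-cong (*-congʳ q (drop-∷ e))) n) ⟩
    a' ℤ.* coeff q n ℤ.+ coeff (shift (p' *ₚ q)) n ≡⟨ sym (coeff-∷* a' p' q n) ⟩
    coeff ((a' ∷ p') *ₚ q) n                      ∎

  *-comm : ∀ p q → (p *ₚ q) ≋ (q *ₚ p)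
  *-comm p q = mk (coeffs p q)
    where
    coeffs : ∀ p q n → coeff (p *ₚ q) n ≡ coeff (q *ₚ p) n
    coeffs []      q       n       = get (≋-sym (*-zeroʳ q)) n
    coeffs (a ∷ p) []      n       = get (*-zeroʳ (a ∷ p)) n
    coeffs (a ∷ p) (b ∷ q) zero    = cong (ℤ._+ 0ℤ) (ℤP.*-comm a b)
    coeffs (a ∷ p) (b ∷ q) (suc n) = begin
      coeff (map (a ℤ.*_) q +ₚ (p *ₚ (b ∷ q))) n
        ≡⟨ coeff-+ (map (a ℤ.*_) q) (p *ₚ (b ∷ q)) n ⟩
      coeff (map (a ℤ.*_) q) n ℤ.+ coeff (p *ₚ (b ∷ q)) n
        ≡⟨ cong₂ ℤ._+_ (coeff-scale a q n) (trans (coeffs p (b ∷ q) n) (coeff-∷* b q p n)) ⟩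
      aq ℤ.+ (bp ℤ.+ coeff (shift (q *ₚ p)) n)
        ≡⟨ cong (λ z → aq ℤ.+ (bp ℤ.+ z)) (get (shift-cong (mk (coeffs q p))) n) ⟩
      aq ℤ.+ (bp ℤ.+ coeff (shift (p *ₚ q)) n)
        ≡⟨ x∙yz≈y∙xz aq bp _ ⟩
      bp ℤ.+ (aq ℤ.+ coeff (shift (p *ₚ q)) n)
        ≡⟨ cong (λ z → bp ℤ.+ z) (sym (coeff-∷* a p q n)) ⟩
      bp ℤ.+ coeff ((a ∷ p) *ₚ q) n
        ≡⟨ cong₂ ℤ._+_ (sym (coeff-scale b p n)) (coeffs (a ∷ p) q n) ⟩
      coeff (map (b ℤ.*_) p) n ℤ.+ coeff (q *ₚ (a ∷ p)) n
        ≡⟨ sym (coeff-+ (map (b ℤ.*_) p) (q *ₚ (a ∷ p)) n) ⟩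
      coeff (map (b ℤ.*_) p +ₚ (q *ₚ (a ∷ p))) n ∎
      where
      aq = a ℤ.* coeff q n
      bp = b ℤ.* coeff p n

  *-congˡ : ∀ p {q q'} → q ≋ q' → (p *ₚ q) ≋ (p *ₚ q')
  *-congˡ p {q} {q'} e = ≋-trans (*-comm p q) (≋-trans (*-congʳ p e) (*-comm q' p))

  *-cong : ∀ {p p' q q'} → p ≋ p' → q ≋ q' → (p *ₚ q) ≋ (p' *ₚ q')
  *-cong {p} {p'} {q} e f = ≋-trans (*-congʳ q e) (*-congˡ p' f)

  coeff-shift-scale : ∀ a p n → coeff (shift (map (a ℤ.*_) p)) n ≡ a ℤ.* coeff (shift p) n
  coeff-shift-scale a p zero    = sym (ℤP.*-zeroʳ a)
  coeff-shift-scale a p (suc n) = coeff-scale a p n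

  coeff-shift-+ : ∀ p q n → coeff (shift (p +ₚ q)) n ≡ coeff (shift p) n ℤ.+ coeff (shift q) n
  coeff-shift-+ p q zero    = refl
  coeff-shift-+ p q (suc n) = coeff-+ p q n

  scale-* : ∀ a p q → (map (a ℤ.*_) p *ₚ q) ≋ map (a ℤ.*_) (p *ₚ q)
  scale-* a []      q = ≋-refl
  scale-* a (b ∷ p) q = mk λ n → begin
    coeff ((a ℤ.* b ∷ map (a ℤ.*_) p) *ₚ q) n
      ≡⟨ coeff-∷* (a ℤ.* b) (map (a ℤ.*_) p) q n ⟩
    a ℤ.* b ℤ.* coeff q n ℤ.+ coeff (shift (map (a ℤ.*_) p *ₚ q)) n
      ≡⟨ cong₂ ℤ._+_ (ℤP.*-assoc a b _)
           (trans (get (shift-cong (scale-* a p q)) n) (coeff-shift-scale a (p *ₚ q) n)) ⟩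
    a ℤ.* (b ℤ.* coeff q n) ℤ.+ a ℤ.* coeff (shift (p *ₚ q)) n
      ≡⟨ sym (ℤP.*-distribˡ-+ a _ _) ⟩
    a ℤ.* (b ℤ.* coeff q n ℤ.+ coeff (shift (p *ₚ q)) n)
      ≡⟨ cong (a ℤ.*_) (sym (coeff-∷* b p q n)) ⟩
    a ℤ.* coeff ((b ∷ p) *ₚ q) n
      ≡⟨ sym (coeff-scale a ((b ∷ p) *ₚ q) n) ⟩
    coeff (map (a ℤ.*_) ((b ∷ p) *ₚ q)) n ∎

  *-distribʳ-+ : ∀ p p' q → ((p +ₚ p') *ₚ q) ≋ ((p *ₚ q) +ₚ (p' *ₚ q))
  *-distribʳ-+ []      p'       q = ≋-refl
  *-distribʳ-+ (a ∷ p) []       q = mk λ n →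
    sym (trans (coeff-+ ((a ∷ p) *ₚ q) [] n) (ℤP.+-identityʳ _))
  *-distribʳ-+ (a ∷ p) (b ∷ p') q = mk λ n → begin
    coeff ((a ℤ.+ b ∷ (p +ₚ p')) *ₚ q) n
      ≡⟨ coeff-∷* (a ℤ.+ b) (p +ₚ p') q n ⟩
    (a ℤ.+ b) ℤ.* coeff q n ℤ.+ coeff (shift ((p +ₚ p') *ₚ q)) n
      ≡⟨ cong₂ ℤ._+_ (ℤP.*-distribʳ-+ (coeff q n) a b)
           (trans (get (shift-cong (*-distribʳ-+ p p' q)) n) (coeff-shift-+ (p *ₚ q) (p' *ₚ q) n)) ⟩
    (a ℤ.* coeff q n ℤ.+ b ℤ.* coeff q n) ℤ.+ (coeff (shift (p *ₚ q)) n ℤ.+ coeff (shift (p' *ₚ q)) n)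
      ≡⟨ interchange (a ℤ.* coeff q n) (b ℤ.* coeff q n) (coeff (shift (p *ₚ q)) n) (coeff (shift (p' *ₚ q)) n) ⟩
    (a ℤ.* coeff q n ℤ.+ coeff (shift (p *ₚ q)) n) ℤ.+ (b ℤ.* coeff q n ℤ.+ coeff (shift (p' *ₚ q)) n)
      ≡⟨ cong₂ ℤ._+_ (sym (coeff-∷* a p q n)) (sym (coeff-∷* b p' q n)) ⟩
    coeff ((a ∷ p) *ₚ q) n ℤ.+ coeff ((b ∷ p') *ₚ q) n
      ≡⟨ sym (coeff-+ ((a ∷ p) *ₚ q) ((b ∷ p') *ₚ q) n) ⟩
    coeff (((a ∷ p) *ₚ q) +ₚ ((b ∷ p') *ₚ q)) n ∎

  shift-* : ∀ p q → (shift p *ₚ q) ≋ shift (p *ₚ q)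
  shift-* p q = mk λ n →
    trans (coeff-∷* 0ℤ p q n)
          (trans (cong (ℤ._+ coeff (shift (p *ₚ q)) n) (ℤP.*-zeroˡ (coeff q n))) (ℤP.+-identityˡ _))

  *-assoc : ∀ p q r → ((p *ₚ q) *ₚ r) ≋ (p *ₚ (q *ₚ r))
  *-assoc []      q r = ≋-refl
  *-assoc (a ∷ p) q r =
    ≋-trans (*-distribʳ-+ (map (a ℤ.*_) q) (shift (p *ₚ q)) r)
      (+-cong (scale-* a q r) (≋-trans (shift-* (p *ₚ q) r) (shift-cong (*-assoc p q r))))

  *-identityˡ : ∀ p → (oneₚ *ₚ p) ≋ p
  *-identityˡ p = mk λ n →
    trans (coeff-∷* 1ℤ [] p n)
          (trans (cong₂ ℤ._+_ (ℤP.*-identityˡ (coeff p n)) (coeff-shift-[] n)) (ℤP.+-identityʳ _))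

  *-isCommutativeMonoid : IsCommutativeMonoid _≋_ _*ₚ_ oneₚ
  *-isCommutativeMonoid = record
    { isMonoid = record
      { isSemigroup = record
        { isMagma = record
          { isEquivalence = ≋-isEquivalence
          ; ∙-cong = *-cong }
        ; assoc = *-assoc }
      ; identity = *-identityˡ , λ p → ≋-trans (*-comm p oneₚ) (*-identityˡ p) }
    ; comm = *-comm }

  prod-↭ : ∀ {xs ys} → xs ↭ ys → prodₚ xs ≋ prodₚ ys
  prod-↭ xs↭ys = PermSetoid.foldr-commMonoid ≋-setoid *-isCommutativeMonoid (↭⇒↭ₛ′ ≋-isEquivalence xs↭ys)

  prod-++ : ∀ xs ys → prodₚ (xs ++ ys) ≋ (prodₚ xs *ₚ prodₚ ys)
  prod-++ []       ys = ≋-sym (*-identityˡ (prodₚ ys))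
  prod-++ (x ∷ xs) ys = ≋-trans (*-congˡ x (prod-++ xs ys)) (≋-sym (*-assoc x (prodₚ xs) (prodₚ ys)))

  prod-concat : ∀ xss → prodₚ (concat xss) ≋ prodₚ (map prodₚ xss)
  prod-concat []         = ≋-refl
  prod-concat (xs ∷ xss) = ≋-trans (prod-++ xs (concat xss)) (*-congˡ (prodₚ xs) (prod-concat xss))

  prod-if : ∀ {P : ℕ → Set} (P? : Decidable P) (f g : ℕ → Poly) xs →
    All (λ r → f r ≡ (if ⌊ P? r ⌋ then g r else oneₚ)) xs → prodₚ (map f xs) ≋ prodₚ (map g (filter P? xs))
  prod-if P? f g []       []       = ≋-refl
  prod-if P? f g (x ∷ xs) (e ∷ es) with P? x
  ... | yes _ = *-cong (≡⇒≋ e) (prod-if P? f g xs es)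
  ... | no _  = ≋-trans (*-congʳ (prodₚ (map f xs)) (≡⇒≋ e)) (≋-trans (*-identityˡ _) (prod-if P? f g xs es))

  prod-pointwise : ∀ {A : Set} {f g : A → Poly} → (∀ x → f x ≋ g x) → ∀ xs → prodₚ (map f xs) ≋ prodₚ (map g xs)
  prod-pointwise f≋g []       = ≋-refl
  prod-pointwise f≋g (x ∷ xs) = *-cong (f≋g x) (prod-pointwise f≋g xs)

open ProductAlgebra

Decreasing : List ℕ → Set
Decreasing = Linked (λ a b → b ≤ a)

conj : List ℕ → ℕ → ℕ
conj []       r = 0
conj (x ∷ xs) r with r ≤? x
... | yes _ = suc (conj xs r)
... | no _  = conj xs r

mult-∷-≡ : ∀ r x xs → r ≡ x → mult r (x ∷ xs) ≡ suc (mult r xs)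
mult-∷-≡ r x xs r≡x = cong length (filter-accept (r ≟_) r≡x)

mult-∷-≢ : ∀ r x xs → ¬ r ≡ x → mult r (x ∷ xs) ≡ mult r xs
mult-∷-≢ r x xs r≢x = cong length (filter-reject (r ≟_) r≢x)

conj-mult : ∀ l r → conj l r ≡ mult r l + conj l (suc r)
conj-mult []       r = refl
conj-mult (x ∷ xs) r with r ≟ x | r ≤? x | suc r ≤? x
... | yes refl | yes _ | yes r<r = ⊥-elim (<-irrefl refl r<r)
... | yes refl | yes _ | no _    rewrite mult-∷-≡ r r xs refl = cong suc (conj-mult xs r)
... | yes refl | no r≰r | _      = ⊥-elim (r≰r ≤-refl)
... | no r≢x   | yes _ | yes _   rewrite mult-∷-≢ r x xs r≢x =
  trans (cong suc (conj-mult xs r)) (sym (+-suc _ _))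
... | no r≢x   | yes r≤x | no r≮x = ⊥-elim (r≮x (ℕP.≤∧≢⇒< r≤x r≢x))
... | no _     | no r≰x | yes r<x = ⊥-elim (r≰x (ℕP.<⇒≤ r<x))
... | no r≢x   | no _  | no _    rewrite mult-∷-≢ r x xs r≢x = conj-mult xs r

part-≤-head : ∀ {x xs} → Decreasing (x ∷ xs) → ∀ k → part xs k ≤ x
part-≤-head {xs = []}    _         k             = z≤n
part-≤-head {xs = y ∷ _} (y≤x ∷ d) zero          = z≤n
part-≤-head {xs = y ∷ _} (y≤x ∷ d) (suc zero)    = y≤x
part-≤-head {xs = y ∷ _} (y≤x ∷ d) (suc (suc k)) = ≤-trans (part-≤-head d (suc k)) y≤x

Decreasing-tail : ∀ {x xs} → Decreasing (x ∷ xs) → Decreasing xs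
Decreasing-tail [-]     = []
Decreasing-tail (_ ∷ d) = d

conj-above-head : ∀ {x xs} r → Decreasing (x ∷ xs) → x < r → conj xs r ≡ 0
conj-above-head {xs = []}     r d         x<r = refl
conj-above-head {xs = y ∷ ys} r (y≤x ∷ d) x<r with r ≤? y
... | yes r≤y = ⊥-elim (<-irrefl refl (ℕP.<-≤-trans x<r (≤-trans r≤y y≤x)))
... | no _    = conj-above-head r d (ℕP.≤-<-trans y≤x x<r)

≤part⇒≤conj : ∀ {l} r k → Decreasing l → 1 ≤ r → r ≤ part l k → k ≤ conj l r
≤part⇒≤conj {[]}     r k d r≥1 r≤ with ≤-trans r≥1 r≤
... | ()
≤part⇒≤conj {x ∷ xs} r zero d r≥1 r≤ = z≤n
≤part⇒≤conj {x ∷ xs} r (suc zero) d r≥1 r≤ with r ≤? x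
... | yes _  = s≤s z≤n
... | no r≰x = ⊥-elim (r≰x r≤)
≤part⇒≤conj {x ∷ xs} r (suc (suc k)) d r≥1 r≤ with r ≤? x
... | yes _  = s≤s (≤part⇒≤conj r (suc k) (Decreasing-tail d) r≥1 r≤)
... | no r≰x = ⊥-elim (r≰x (≤-trans r≤ (part-≤-head d (suc k))))

≤conj⇒≤part : ∀ {l} r k → Decreasing l → 1 ≤ k → k ≤ conj l r → r ≤ part l k
≤conj⇒≤part {x ∷ xs} r (suc k) d k≥1 k≤ with r ≤? x
≤conj⇒≤part {x ∷ xs} r (suc zero)    d _ k≤ | yes r≤x = r≤x
≤conj⇒≤part {x ∷ xs} r (suc (suc k)) d _ k≤ | yes _   =
  ≤conj⇒≤part r (suc k) (Decreasing-tail d) (s≤s z≤n) (ℕP.≤-pred k≤)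
... | no r≰x = ⊥-elim (<-irrefl refl
  (ℕP.<-≤-trans (s≤s z≤n) (≤-trans k≤ (≤-reflexive (conj-above-head r d (ℕP.≰⇒> r≰x))))))

conj-≤-length : ∀ l r → conj l r ≤ length l
conj-≤-length []       r = z≤n
conj-≤-length (x ∷ xs) r with r ≤? x
... | yes _ = s≤s (conj-≤-length xs r)
... | no _  = ℕP.m≤n⇒m≤1+n (conj-≤-length xs r)

part-pos⇒≤length : ∀ l k → 1 ≤ part l k → k ≤ length l
part-pos⇒≤length []       k             ()
part-pos⇒≤length (x ∷ xs) zero          p = z≤n
part-pos⇒≤length (x ∷ xs) (suc zero)    p = s≤s z≤n
part-pos⇒≤length (x ∷ xs) (suc (suc k)) p = s≤s (part-pos⇒≤length xs (suc k) p)

≤length⇒part-pos : ∀ {l} k → All (λ a → 1 ≤ a) l → 1 ≤ k → k ≤ length l → 1 ≤ part l k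
≤length⇒part-pos {x ∷ xs} (suc zero)    (x≥1 ∷ _) _ _         = x≥1
≤length⇒part-pos {x ∷ xs} (suc (suc k)) (_ ∷ ps)  _ (s≤s k≤) = ≤length⇒part-pos (suc k) ps (s≤s z≤n) k≤

part-in-band : ∀ l r k → Decreasing l → 1 ≤ r → conj l (suc r) < k → k ≤ conj l r → part l k ≡ r
part-in-band l r k d r≥1 lo hi = ℕP.≤-antisym
  (ℕP.≮⇒≥ (λ r<λk → <-irrefl refl (ℕP.<-≤-trans lo (≤part⇒≤conj (suc r) k d (s≤s z≤n) r<λk))))
  (≤conj⇒≤part r k d (≤-trans (s≤s z≤n) lo) hi)

module _ {p} {P : Pred ℕ p} (P? : Decidable P) where

  count-none : ∀ n f → (∀ k → ¬ P (f k)) → length (filter P? (applyUpTo f n)) ≡ 0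
  count-none zero    f none = refl
  count-none (suc n) f none =
    trans (cong length (filter-reject P? (none 0))) (count-none n (f ∘ suc) (none ∘ suc))

  count-interval : ∀ n f a b → a ≤ b → b ≤ n →
    (∀ k → P (f k) → a ≤ k × k < b) → (∀ k → a ≤ k → k < b → P (f k)) →
    length (filter P? (applyUpTo f n)) + a ≡ b
  count-interval n f zero zero z≤n _ only _ =
    trans (+-identityʳ _) (count-none n f (λ k Pk → ℕP.n≮0 (proj₂ (only k Pk))))
  count-interval (suc n) f zero (suc b) _ (s≤s b≤n) only all =
    trans (cong (λ xs → length xs + 0) (filter-accept P? (all 0 z≤n (s≤s z≤n))))
      (cong suc (count-interval n (f ∘ suc) zero b z≤n b≤n
        (λ k Pk → z≤n , ℕP.≤-pred (proj₂ (only (suc k) Pk)))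
        (λ k _ k<b → all (suc k) z≤n (s≤s k<b))))
  count-interval (suc n) f (suc a) (suc b) (s≤s a≤b) (s≤s b≤n) only all =
    trans (cong (λ xs → length xs + suc a) (filter-reject P? (λ Pk → ℕP.n≮0 (proj₁ (only 0 Pk)))))
      (trans (+-suc _ a) (cong suc (count-interval n (f ∘ suc) a b a≤b b≤n
        (λ k Pk → ℕP.≤-pred (proj₁ (only (suc k) Pk)) , ℕP.≤-pred (proj₂ (only (suc k) Pk)))
        (λ k a≤k k<b → all (suc k) (s≤s a≤k) (s≤s k<b)))))

-- θ'_r + μ'_r = λ'_r for θ = λ/μ (the cells of column r are rows μ'_r < k ≤ λ'_r)
colCount-conj : ∀ l m r → Decreasing l → Decreasing m → 1 ≤ r → conj m r ≤ conj l r →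
  colCount l m r + conj m r ≡ conj l r
colCount-conj l m r dl dm r≥1 m≤l =
  count-interval _ (length l) (λ k → k) (conj m r) (conj l r) m≤l (conj-≤-length l r) only all
  where
  only : ∀ k → (part m (suc k) < r × r ≤ part l (suc k)) → conj m r ≤ k × k < conj l r
  only k (μ<r , r≤λ) with conj m r ≤? k
  ... | yes m≤k = m≤k , ≤part⇒≤conj r (suc k) dl r≥1 r≤λ
  ... | no m≰k  = ⊥-elim (<-irrefl refl
    (ℕP.<-≤-trans μ<r (≤conj⇒≤part r (suc k) dm (s≤s z≤n) (ℕP.≰⇒> m≰k))))
  all : ∀ k → conj m r ≤ k → k < conj l r → (part m (suc k) < r × r ≤ part l (suc k))
  all k m≤k k<l =
    ℕP.≰⇒> (λ r≤μ → <-irrefl refl (ℕP.<-≤-trans (≤part⇒≤conj r (suc k) dm r≥1 r≤μ) m≤k)) ,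
    ≤conj⇒≤part r (suc k) dl (s≤s z≤n) k<l

strip-conj-≥ : ∀ l m r → Decreasing l → Decreasing m → 1 ≤ r → HStrip l m → conj m r ≤ conj l r
strip-conj-≥ l m r dl dm r≥1 hs with conj m r in eq
... | zero  = z≤n
... | suc k = ≤part⇒≤conj r (suc k) dl r≥1
  (≤-trans (≤conj⇒≤part r (suc k) dm (s≤s z≤n) (≤-reflexive (sym eq))) (proj₁ (hs k)))

strip-conj-≤ : ∀ l m r → Decreasing l → Decreasing m → 1 ≤ r → HStrip l m → conj l r ≤ suc (conj m r)
strip-conj-≤ l m r dl dm r≥1 hs with conj l r in eq
... | zero        = z≤n
... | suc zero    = s≤s z≤n
... | suc (suc k) = s≤s (≤part⇒≤conj r (suc k) dm r≥1
  (≤-trans (≤conj⇒≤part r (suc (suc k)) dl (s≤s z≤n) (≤-reflexive (sym eq))) (proj₂ (hs k))))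

-- The four possible shapes of columns r, r+1 of a horizontal strip
-- (x = θ'_r, y = θ'_{r+1}, a = m_r(λ), b = m_r(μ)).
data ColumnStep : ℕ → ℕ → ℕ → ℕ → Set where
  rise  : ∀ {b} → ColumnStep 1 0 (suc b) b   -- r ∈ I_{λ/μ}
  fall  : ∀ {a} → ColumnStep 0 1 a (suc a)   -- r ∈ J_{λ/μ}
  empty : ∀ {a} → ColumnStep 0 0 a a
  full  : ∀ {a} → ColumnStep 1 1 a a

columnStep-shape : ∀ {x y a b} → x ≤ 1 → y ≤ 1 → x + b ≡ a + y → ColumnStep x y a b
columnStep-shape {a = a} z≤n       z≤n       e = subst (ColumnStep 0 0 a) (sym (trans e (+-identityʳ a))) empty
columnStep-shape {a = a} z≤n       (s≤s z≤n) e = subst (ColumnStep 0 1 a) (sym (trans e (+-comm a 1))) fall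
columnStep-shape {b = b} (s≤s z≤n) z≤n       e = subst (λ a → ColumnStep 1 0 a b) (trans e (+-identityʳ _)) rise
columnStep-shape {a = a} (s≤s z≤n) (s≤s z≤n) e =
  subst (ColumnStep 1 1 a) (sym (ℕP.suc-injective (trans e (+-comm a 1)))) full

-- every column pair of a horizontal strip has one of these shapes, since
-- θ'_r, θ'_{r+1} ≤ 1 and θ'_r + m_r(μ) = m_r(λ) + θ'_{r+1}
columnStep : ∀ l m r → Decreasing l → Decreasing m → HStrip l m → 1 ≤ r →
  ColumnStep (colCount l m r) (colCount l m (suc r)) (mult r l) (mult r m)
columnStep l m r dl dm hs r≥1 = columnStep-shape (θ≤1 r r≥1) (θ≤1 (suc r) (s≤s z≤n)) balance
  where
  θ+μ'≡λ' : ∀ s → 1 ≤ s → colCount l m s + conj m s ≡ conj l s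
  θ+μ'≡λ' s s≥1 = colCount-conj l m s dl dm s≥1 (strip-conj-≥ l m s dl dm s≥1 hs)
  θ≤1 : ∀ s → 1 ≤ s → colCount l m s ≤ 1
  θ≤1 s s≥1 = ℕP.+-cancelʳ-≤ (conj m s) _ 1
    (≤-trans (≤-reflexive (θ+μ'≡λ' s s≥1)) (strip-conj-≤ l m s dl dm s≥1 hs))
  x = colCount l m r
  y = colCount l m (suc r)
  balance : x + mult r m ≡ mult r l + y
  balance = ℕP.+-cancelʳ-≡ (conj m (suc r)) _ _ (begin
    x + mult r m + conj m (suc r)   ≡⟨ +-assoc x (mult r m) _ ⟩
    x + (mult r m + conj m (suc r)) ≡⟨ cong (x +_) (sym (conj-mult m r)) ⟩
    x + conj m r                    ≡⟨ θ+μ'≡λ' r r≥1 ⟩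
    conj l r                        ≡⟨ conj-mult l r ⟩
    mult r l + conj l (suc r)       ≡⟨ cong (mult r l +_) (sym (θ+μ'≡λ' (suc r) (s≤s z≤n))) ⟩
    mult r l + (y + conj m (suc r)) ≡⟨ sym (+-assoc (mult r l) y _) ⟩
    mult r l + y + conj m (suc r)   ∎)
    where open ≡-Reasoning

⌊⌋-yes : ∀ {P : Set} (P? : Dec P) → P → ⌊ P? ⌋ ≡ true
⌊⌋-yes P? p = trans (isYes≗does P?) (dec-true P? p)

⌊⌋-no : ∀ {P : Set} (P? : Dec P) → ¬ P → ⌊ P? ⌋ ≡ false
⌊⌋-no P? ¬p = trans (isYes≗does P?) (dec-false P? ¬p)

I-condition : ∀ {x y a b} → ColumnStep x y a b → (⌊ x ≟ 1 ⌋ ∧ ⌊ y ≟ 0 ⌋) ≡ ⌊ a ≟ suc b ⌋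
I-condition (rise {b}) = sym (⌊⌋-yes (suc b ≟ suc b) refl)
I-condition (fall {a}) = sym (⌊⌋-no (a ≟ suc (suc a)) (ℕP.<⇒≢ (ℕP.m<n⇒m<1+n (ℕP.n<1+n a))))
I-condition (empty {a}) = sym (⌊⌋-no (a ≟ suc a) (ℕP.<⇒≢ (ℕP.n<1+n a)))
I-condition (full {a}) = sym (⌊⌋-no (a ≟ suc a) (ℕP.<⇒≢ (ℕP.n<1+n a)))

J-condition : ∀ {x y a b} → ColumnStep x y a b → (⌊ x ≟ 0 ⌋ ∧ ⌊ y ≟ 1 ⌋) ≡ ⌊ b ≟ suc a ⌋
J-condition (rise {b}) = sym (⌊⌋-no (b ≟ suc (suc b)) (ℕP.<⇒≢ (ℕP.m<n⇒m<1+n (ℕP.n<1+n b))))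
J-condition (fall {a}) = sym (⌊⌋-yes (suc a ≟ suc a) refl)
J-condition (empty {a}) = sym (⌊⌋-no (a ≟ suc a) (ℕP.<⇒≢ (ℕP.n<1+n a)))
J-condition (full {a}) = sym (⌊⌋-no (a ≟ suc a) (ℕP.<⇒≢ (ℕP.n<1+n a)))

ColumnStep-a≤1+b : ∀ {x y a b} → ColumnStep x y a b → a ≤ suc b
ColumnStep-a≤1+b rise  = ≤-refl
ColumnStep-a≤1+b fall  = ℕP.m≤n⇒m≤1+n (ℕP.n≤1+n _)
ColumnStep-a≤1+b empty = ℕP.n≤1+n _
ColumnStep-a≤1+b full  = ℕP.n≤1+n _

ColumnStep-b≤1+a : ∀ {x y a b} → ColumnStep x y a b → b ≤ suc a
ColumnStep-b≤1+a rise  = ℕP.m≤n⇒m≤1+n (ℕP.n≤1+n _)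
ColumnStep-b≤1+a fall  = ≤-refl
ColumnStep-b≤1+a empty = ℕP.n≤1+n _
ColumnStep-b≤1+a full  = ℕP.n≤1+n _

squeeze : ∀ {x y} → x ≤ y → y ≤ suc x → y ≡ x ⊎ y ≡ suc x
squeeze x≤y y≤1+x with ℕP.m≤n⇒m<n∨m≡n y≤1+x
... | inj₁ y<1+x = inj₁ (ℕP.≤-antisym (ℕP.≤-pred y<1+x) x≤y)
... | inj₂ y≡1+x = inj₂ y≡1+x

∈-range1 : ∀ l r → 1 ≤ r → 1 ≤ conj l r → Decreasing l → r ∈ range1 l
∈-range1 l (suc r) _ λ'≥1 d = ∈-map⁺ suc (∈-upTo⁺ (≤conj⇒≤part (suc r) 1 d (s≤s z≤n) λ'≥1))

range1-pos : ∀ l r → r ∈ range1 l → 1 ≤ r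
range1-pos l r r∈ with ∈-map⁻ suc r∈
... | _ , _ , refl = s≤s z≤n

-- entry c of a vector of lists, read as ∅ beyond its length
entry : ∀ {n} → Vec (List ℕ) n → ℕ → List ℕ
entry []       _       = []
entry (l ∷ _)  zero    = l
entry (_ ∷ ls) (suc c) = entry ls c

entry-lookup : ∀ {n} (ls : Vec (List ℕ) n) (i : Fin n) → entry ls (toℕ i) ≡ lookup ls i
entry-lookup (l ∷ ls) zero     = refl
entry-lookup (l ∷ ls) (fsuc i) = entry-lookup ls i

module Diagram {N : ℕ} (ls : Vec (List ℕ) (suc N)) (A : Vec Bit N)
  (interlacing : Seq.Interlacing ls A) (λ⁰≡∅ : lookup ls zero ≡ []) where

  open Seq ls A

  decreasing : ∀ i → Decreasing (lam i)
  decreasing i = proj₁ (proj₁ interlacing i)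

  positive : ∀ i → All (λ a → 1 ≤ a) (lam i)
  positive i = proj₂ (proj₁ interlacing i)

  prev next : Fin N → List ℕ
  prev j = lam (inject₁ j)
  next j = lam (fsuc j)

  strip-up : ∀ j → lookup A j ≡ 𝟎 → HStrip (next j) (prev j)
  strip-up j = proj₁ (proj₂ interlacing j)

  strip-down : ∀ j → lookup A j ≡ 𝟏 → HStrip (prev j) (next j)
  strip-down j = proj₂ (proj₂ interlacing j)

  -- column c is λᶜ, indexed by natural numbers so that `start` below can
  -- recurse on it
  column : ℕ → List ℕ
  column = entry ls

  column-prev : ∀ j → column (toℕ j) ≡ prev j
  column-prev j = trans (cong column (sym (FinP.toℕ-inject₁ j))) (entry-lookup ls (inject₁ j))

  column-0 : column 0 ≡ []
  column-0 = trans (entry-lookup ls zero) λ⁰≡∅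

  no-box-in-column-0 : ∀ {k} → ¬ IsBox (zero , k)
  no-box-in-column-0 (k≥1 , k≤ℓ) =
    <-irrefl refl (ℕP.<-≤-trans k≥1 (≤-trans k≤ℓ (≤-reflexive (cong length λ⁰≡∅))))

  box-fill-pos : ∀ {i k} → IsBox (i , k) → 1 ≤ fill (i , k)
  box-fill-pos {i} {k} (k≥1 , k≤ℓ) = ≤length⇒part-pos k (positive i) k≥1 k≤ℓ

  fill-along : ∀ {b c} → Star CompEdge b c → fill b ≡ fill c
  fill-along ε              = refl
  fill-along ((_ , e) ◅ es) = trans e (fill-along es)

  -- Two vertically neighbouring boxes with equal fill lie in the same
  -- connected component: they are joined through the column to their left.
  vertical-connect : ∀ i k → IsBox (i , k) → IsBox (i , suc k) → fill (i , k) ≡ fill (i , suc k) →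
    Star CompEdge (i , k) (i , suc k)
  vertical-connect zero     k        box _ _ = ⊥-elim (no-box-in-column-0 box)
  vertical-connect (fsuc j) (suc k₀) box box' same with lookup A j in Aj
  ... | 𝟎 = e₁ ◅ e₂ ◅ ε
    where
    k = suc k₀
    hs = strip-up j Aj
    left≡ : part (prev j) k ≡ part (next j) k
    left≡ = ℕP.≤-antisym (proj₁ (hs k₀)) (≤-trans (≤-reflexive same) (proj₂ (hs k₀)))
    left-box : IsBox (inject₁ j , k)
    left-box = s≤s z≤n , part-pos⇒≤length (prev j) k (≤-trans (box-fill-pos box) (≤-reflexive (sym left≡)))
    e₁ : CompEdge (fsuc j , k) (inject₁ j , k)
    e₁ = (box , left-box , inj₂ (j , refl , refl , inj₁ (Aj , inj₁ refl))) , sym left≡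
    e₂ : CompEdge (inject₁ j , k) (fsuc j , suc k)
    e₂ = (left-box , box' , inj₁ (j , refl , refl , inj₁ (Aj , inj₂ refl))) , trans left≡ same
  ... | 𝟏 = e₁ ◅ e₂ ◅ ε
    where
    k = suc k₀
    hs = strip-down j Aj
    left≡ : part (prev j) (suc k) ≡ part (next j) k
    left≡ = ℕP.≤-antisym (proj₂ (hs k₀)) (≤-trans (≤-reflexive same) (proj₁ (hs k)))
    left-box : IsBox (inject₁ j , suc k)
    left-box = s≤s z≤n , part-pos⇒≤length (prev j) (suc k) (≤-trans (box-fill-pos box) (≤-reflexive (sym left≡)))
    e₁ : CompEdge (fsuc j , k) (inject₁ j , suc k)
    e₁ = (box , left-box , inj₂ (j , refl , refl , inj₂ (Aj , inj₁ refl))) , sym left≡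
    e₂ : CompEdge (inject₁ j , suc k) (fsuc j , suc k)
    e₂ = (left-box , box' , inj₁ (j , refl , refl , inj₂ (Aj , inj₂ refl))) , trans left≡ same

  module Band (i : Fin (suc N)) (r : ℕ) (r≥1 : 1 ≤ r) where

    top bottom : ℕ
    top    = conj (lam i) (suc r)
    bottom = conj (lam i) r

    band-box : ∀ k → top < k → k ≤ bottom → IsBox (i , k) × fill (i , k) ≡ r
    band-box k top<k k≤bot =
      (≤-trans (s≤s z≤n) top<k , ≤-trans k≤bot (conj-≤-length (lam i) r)) ,
      part-in-band (lam i) r k (decreasing i) r≥1 top<k k≤bot

    band-connected : ∀ k → top < k → ∀ h → k + h ≤ bottom → Star CompEdge (i , k) (i , k + h)
    band-connected k top<k zero    _ = subst (λ z → Star CompEdge (i , k) (i , z)) (sym (+-identityʳ k)) ε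
    band-connected k top<k (suc h) k+h<bot =
      subst (λ z → Star CompEdge (i , k) (i , z)) (sym (+-suc k h))
        (band-connected k top<k h (ℕP.<⇒≤ k+h<bot′) ◅◅
         vertical-connect i (k + h) (proj₁ upper) (proj₁ lower) (trans (proj₂ upper) (sym (proj₂ lower))))
      where
      k+h<bot′ : suc (k + h) ≤ bottom
      k+h<bot′ = ≤-trans (≤-reflexive (sym (+-suc k h))) k+h<bot
      top<k+h : top < k + h
      top<k+h = ℕP.<-≤-trans top<k (ℕP.m≤m+n k h)
      upper = band-box (k + h) top<k+h (ℕP.<⇒≤ k+h<bot′)
      lower = band-box (suc (k + h)) (ℕP.m≤n⇒m≤1+n top<k+h) k+h<bot′

    below-band : ∀ k z → fill (i , k) ≡ r → z ≡ suc bottom → ¬ InComp (i , k) (i , z)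
    below-band k z fk z≡ (_ , _ , path) = <-irrefl refl
      (subst (_≤ bottom) z≡ (≤part⇒≤conj r z (decreasing i) r≥1 (≤-reflexive (trans (sym fk) (fill-along path)))))

    module _ (k : ℕ) (box : IsBox (i , k)) (fk : fill (i , k) ≡ r) where

      top<k : top < k
      top<k = ℕP.≰⇒> (λ k≤top → <-irrefl refl
        (≤-trans (≤conj⇒≤part (suc r) k (decreasing i) (proj₁ box) k≤top) (≤-reflexive fk)))

      k≤bottom : k ≤ bottom
      k≤bottom = ≤part⇒≤conj r k (decreasing i) r≥1 (≤-reflexive (sym fk))

      level-pos : ∀ h → k + h ≡ suc bottom → 1 ≤ h
      level-pos zero    e = ⊥-elim (<-irrefl refl (≤-trans (≤-reflexive (trans (sym e) (+-identityʳ k))) k≤bottom))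
      level-pos (suc h) e = s≤s z≤n

      level-intro : ∀ h → k + h ≡ suc bottom → Level (i , k) h
      level-intro h e = level-pos h e , below-band k (k + h) fk e , inside
        where
        inside : ∀ h' → 1 ≤ h' → h' < h → InComp (i , k) (i , k + h')
        inside h' _ h'<h = box , proj₁ (band-box (k + h') (ℕP.<-≤-trans top<k (ℕP.m≤m+n k h')) in-band) ,
                           band-connected k top<k h' in-band
          where
          in-band : k + h' ≤ bottom
          in-band = ℕP.≤-pred (≤-trans (ℕP.+-monoʳ-< k h'<h) (≤-reflexive e))

      d : ℕ
      d = suc bottom ∸ k
      k+d≡ : k + d ≡ suc bottom
      k+d≡ = ℕP.m+[n∸m]≡n (ℕP.m≤n⇒m≤1+n k≤bottom)

      level-form : ∀ h → Level (i , k) h → k + h ≡ suc bottom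
      level-form h (_ , outside , inside) with ℕP.<-cmp h d
      ... | tri< h<d _ _ = ⊥-elim (outside (box , proj₁ (band-box (k + h) top<k+h in-band) ,
                                            band-connected k top<k h in-band))
        where
        in-band : k + h ≤ bottom
        in-band = ℕP.≤-pred (≤-trans (ℕP.+-monoʳ-< k h<d) (≤-reflexive k+d≡))
        top<k+h : top < k + h
        top<k+h = ℕP.<-≤-trans top<k (ℕP.m≤m+n k h)
      ... | tri≈ _ h≡d _ = trans (cong (k +_) h≡d) k+d≡
      ... | tri> _ _ d<h = ⊥-elim (below-band k (k + d) fk k+d≡ (inside d (level-pos d k+d≡) d<h))

      level-≤-mult : ∀ h → Level (i , k) h → h ≤ mult r (lam i)
      level-≤-mult h lv = ℕP.+-cancelʳ-≤ (suc top) h (mult r (lam i)) (begin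
        h + suc top         ≤⟨ ℕP.+-monoʳ-≤ h top<k ⟩
        h + k               ≡⟨ +-comm h k ⟩
        k + h               ≡⟨ level-form h lv ⟩
        suc bottom          ≡⟨ cong suc (conj-mult (lam i) r) ⟩
        suc (mult r (lam i) + top) ≡⟨ sym (+-suc (mult r (lam i)) top) ⟩
        mult r (lam i) + suc top ∎)
        where open ℕP.≤-Reasoning

  level-form : ∀ {i k h} → IsBox (i , k) → Level (i , k) h → k + h ≡ suc (conj (lam i) (fill (i , k)))
  level-form {i} {k} {h} box lv = Band.level-form i (fill (i , k)) (box-fill-pos box) k box refl h lv

  level-unique : ∀ {b h h'} → IsBox b → Level b h → Level b h' → h ≡ h'
  level-unique {_ , k} box lv lv' = ℕP.+-cancelˡ-≡ k _ _ (trans (level-form box lv) (sym (level-form box lv')))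

  level-≤-mult : ∀ {i k h} → IsBox (i , k) → Level (i , k) h → h ≤ mult (fill (i , k)) (lam i)
  level-≤-mult {i} {k} {h} box lv = Band.level-≤-mult i (fill (i , k)) (box-fill-pos box) k box refl h lv

  -- start r h c: the last column c' < c with m_r(λ^{c'}) < h.  A border
  -- component of fill r and level h occupies the columns right after it.
  start : ℕ → ℕ → ℕ → ℕ
  start r h zero    = zero
  start r h (suc c) with h ≤? mult r (column c)
  ... | yes _ = start r h c
  ... | no _  = c

  start-stop : ∀ r h c → ¬ h ≤ mult r (column c) → start r h (suc c) ≡ c
  start-stop r h c h≰ with h ≤? mult r (column c)
  ... | yes h≤ = ⊥-elim (h≰ h≤)
  ... | no _   = refl

  start-continue : ∀ r h c → h ≤ mult r (column c) → start r h (suc c) ≡ start r h c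
  start-continue r h c h≤ with h ≤? mult r (column c)
  ... | yes _  = refl
  ... | no h≰ = ⊥-elim (h≰ h≤)

  -- The key of a border component: (start column, fill, level).
  Key : Set
  Key = ℕ × ℕ × ℕ

  key-at : Pos → ℕ → Key
  key-at (i , k) h = start (fill (i , k)) h (toℕ i) , fill (i , k) , h

  key : Rep → Key
  key (b , h) = key-at b h

  -- Adjacent boxes of equal fill and level share their key: the box on the
  -- left has level h ≤ m_r(λʲ), so `start` skips over column j.
  key-adjacent : ∀ {p q h} → AdjDir p q → fill p ≡ fill q → IsBox p → Level p h → key-at p h ≡ key-at q h
  key-adjacent {i , k} {q} {h} (j , refl , refl , _) same box lv = begin
    start r h (toℕ (inject₁ j)) , r , h ≡⟨ cong (λ c → start r h c , r , h) (FinP.toℕ-inject₁ j) ⟩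
    start r h (toℕ j) , r , h           ≡⟨ cong (_, r , h) (sym (start-continue r h (toℕ j) h≤m)) ⟩
    start r h (suc (toℕ j)) , r , h     ≡⟨ cong (λ r' → start r' h (suc (toℕ j)) , r' , h) same ⟩
    key-at q h                          ∎
    where
    open ≡-Reasoning
    r = fill (i , k)
    h≤m : h ≤ mult r (column (toℕ j))
    h≤m = ≤-trans (level-≤-mult box lv) (≤-reflexive (cong (mult r) (sym (column-prev j))))

  key-border-edge : ∀ {b b' h} → BorderEdge b b' → Level b h → Level b' h → key-at b h ≡ key-at b' h
  key-border-edge (((box , _ , inj₁ adj) , same) , _) lv lv' = key-adjacent adj same box lv
  key-border-edge (((_ , box' , inj₂ adj) , same) , _) lv lv' = sym (key-adjacent adj (sym same) box' lv')

  key-border : ∀ {b c h h'} → SameBorder b c → IsBox b → Level b h → Level c h' → key-at b h ≡ key-at c h'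
  key-border {b} ε box lv lv' = cong (key-at b) (level-unique box lv lv')
  key-border {b} (e@((((_ , box' , _) , _) , (_ , lv₁ , lv₂))) ◅ es) box lv lv' =
    trans (cong (key-at b) (level-unique box lv lv₁)) (trans (key-border-edge e lv₁ lv₂) (key-border es box' lv₂ lv'))

  SameBorder-sym : ∀ {b b'} → SameBorder b b' → SameBorder b' b
  SameBorder-sym = reverse λ { (((box , box' , adj) , same) , (h , lv , lv')) →
    ((box' , box , swap adj) , sym same) , (h , lv' , lv) }

  -- Across step j, rows with the same level in the same value-band are
  -- adjacent: λ'_r changes by at most one, in the direction allowed by Aⱼ.
  adjacent-in-band : ∀ j r {k k' h} → 1 ≤ r →
    k + h ≡ suc (conj (next j) r) → k' + h ≡ suc (conj (prev j) r) → AdjDir (inject₁ j , k') (fsuc j , k)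
  adjacent-in-band j r {k} {k'} {h} r≥1 ek ek' with lookup A j in Aj
  ... | 𝟎 = j , refl , refl , inj₁ (Aj , rows (squeeze (strip-conj-≥ _ _ r (decreasing _) (decreasing _) r≥1 hs)
                                                       (strip-conj-≤ _ _ r (decreasing _) (decreasing _) r≥1 hs)))
    where
    hs = strip-up j Aj
    rows : conj (next j) r ≡ conj (prev j) r ⊎ conj (next j) r ≡ suc (conj (prev j) r) → k ≡ k' ⊎ k ≡ suc k'
    rows (inj₁ e) = inj₁ (ℕP.+-cancelʳ-≡ h k k' (trans ek (trans (cong suc e) (sym ek'))))
    rows (inj₂ e) = inj₂ (ℕP.+-cancelʳ-≡ h k (suc k') (trans ek (trans (cong suc e) (cong suc (sym ek')))))
  ... | 𝟏 = j , refl , refl , inj₂ (Aj , rows (squeeze (strip-conj-≥ _ _ r (decreasing _) (decreasing _) r≥1 hs)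
                                                       (strip-conj-≤ _ _ r (decreasing _) (decreasing _) r≥1 hs)))
    where
    hs = strip-down j Aj
    rows : conj (prev j) r ≡ conj (next j) r ⊎ conj (prev j) r ≡ suc (conj (next j) r) → suc k ≡ k' ⊎ k ≡ k'
    rows (inj₁ e) = inj₂ (ℕP.+-cancelʳ-≡ h k k' (trans ek (trans (cong suc (sym e)) (sym ek'))))
    rows (inj₂ e) = inj₁ (ℕP.+-cancelʳ-≡ h (suc k) k' (trans (cong suc ek) (trans (cong suc (sym e)) (sym ek'))))

  -- A box of level h and fill r in column j+1 has a border neighbour in
  -- column j as soon as m_r(λʲ) ≥ h: the box of the r-band of λʲ of level h.
  left-neighbour : ∀ j k h r → fill (fsuc j , k) ≡ r → IsBox (fsuc j , k) → Level (fsuc j , k) h →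
    h ≤ mult r (prev j) →
    Σ ℕ λ k' → IsBox (inject₁ j , k') × fill (inject₁ j , k') ≡ r × Level (inject₁ j , k') h ×
               BorderEdge (fsuc j , k) (inject₁ j , k')
  left-neighbour j k h r fk box lv h≤m =
    k' , box' , fk' , lv' , (((box , box' , inj₂ adj) , trans fk (sym fk')) , (h , lv , lv'))
    where
    r≥1 : 1 ≤ r
    r≥1 = subst (1 ≤_) fk (box-fill-pos box)
    open Band (inject₁ j) r r≥1 using (top; bottom; band-box; level-intro)
    bottom≡ : bottom ≡ mult r (prev j) + top
    bottom≡ = conj-mult (prev j) r
    h≤bottom : h ≤ bottom
    h≤bottom = ≤-trans h≤m (≤-trans (ℕP.m≤m+n _ top) (≤-reflexive (sym bottom≡)))
    k' = suc bottom ∸ h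
    ek' : k' + h ≡ suc bottom
    ek' = ℕP.m∸n+n≡m (ℕP.m≤n⇒m≤1+n h≤bottom)
    k'≤bottom : k' ≤ bottom
    k'≤bottom = ℕP.≤-pred (≤-trans (≤-reflexive (+-comm 1 k')) (≤-trans (ℕP.+-monoʳ-≤ k' (proj₁ lv)) (≤-reflexive ek')))
    top<k' : top < k'
    top<k' = ℕP.+-cancelʳ-≤ h (suc top) k' (begin
      suc top + h                ≤⟨ ℕP.+-monoʳ-≤ (suc top) h≤m ⟩
      suc top + mult r (prev j)  ≡⟨ cong suc (+-comm top _) ⟩
      suc (mult r (prev j) + top) ≡⟨ cong suc (sym bottom≡) ⟩
      suc bottom                 ≡⟨ sym ek' ⟩
      k' + h                     ∎)
      where open ℕP.≤-Reasoning
    box' = proj₁ (band-box k' top<k' k'≤bottom)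
    fk' = proj₂ (band-box k' top<k' k'≤bottom)
    lv' : Level (inject₁ j , k') h
    lv' = level-intro k' box' fk' h (trans (+-comm k' h) (trans (+-comm h k') ek'))
    adj : AdjDir (inject₁ j , k') (fsuc j , k)
    adj = adjacent-in-band j r r≥1 (trans (level-form box lv) (cong (λ z → suc (conj (next j) z)) fk)) ek'

  -- The leftmost column of a border component: walking left from a box of
  -- fill r and level h stays in its border component until reaching a column
  -- j+1 with m_r(λʲ) < h; that column is determined by `start`.
  record Origin (r h s : ℕ) (b : Pos) : Set where
    field
      step   : Fin N
      row    : ℕ
      reach  : SameBorder b (fsuc step , row)
      box    : IsBox (fsuc step , row)
      level  : Level (fsuc step , row) h
      filled : fill (fsuc step , row) ≡ r
      starts : toℕ step ≡ s
      fresh  : mult r (prev step) < h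

  walk-left : ∀ c (j : Fin N) → toℕ j ≡ c → ∀ k h r → fill (fsuc j , k) ≡ r → IsBox (fsuc j , k) →
    Level (fsuc j , k) h → Origin r h (start r h (suc c)) (fsuc j , k)
  walk-left zero zero _ k h r fk box lv with h ≤? mult r (column 0)
  ... | yes h≤m = ⊥-elim (<-irrefl refl (≤-trans (proj₁ lv) (≤-trans h≤m (≤-reflexive (cong (mult r) column-0)))))
  ... | no h≰m  = record { step = zero ; row = k ; reach = ε ; box = box ; level = lv ; filled = fk
                         ; starts = refl ; fresh = ℕP.≰⇒> (λ h≤m → h≰m (≤-trans h≤m (≤-reflexive
                             (cong (mult r) (sym (column-prev zero)))))) }
  walk-left (suc c) (fsuc j₀) toℕj≡ k h r fk box lv with h ≤? mult r (column (suc c))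
  ... | no h≰m = record { step = fsuc j₀ ; row = k ; reach = ε ; box = box ; level = lv ; filled = fk
                        ; starts = toℕj≡ ; fresh = ℕP.≰⇒> (λ h≤m → h≰m (≤-trans h≤m (≤-reflexive
                            (cong (mult r) (trans (sym (column-prev (fsuc j₀))) (cong column toℕj≡)))))) }
  ... | yes h≤m with left-neighbour (fsuc j₀) k h r fk box lv
                       (≤-trans h≤m (≤-reflexive (cong (mult r) (trans (cong column (sym toℕj≡)) (column-prev (fsuc j₀))))))
  ...   | k' , box' , fk' , lv' , edge =
    record { step = step ; row = row ; reach = edge ◅ reach ; box = box₀ ; level = level
           ; filled = filled ; starts = starts ; fresh = fresh }
    where
    open Origin (walk-left c (inject₁ j₀) (trans (FinP.toℕ-inject₁ j₀) (ℕP.suc-injective toℕj≡)) k' h r fk' box' lv')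
      renaming (box to box₀)

  origin : ∀ {i k h} → IsBox (i , k) → Level (i , k) h →
    Origin (fill (i , k)) h (start (fill (i , k)) h (toℕ i)) (i , k)
  origin {zero}   box lv = ⊥-elim (no-box-in-column-0 box)
  origin {fsuc j} {k} {h} box lv = walk-left (toℕ j) j refl k h (fill (fsuc j , k)) refl box lv

  -- A rise of r at step j: m_r(λʲ⁺¹) = m_r(λʲ) + 1.  By the column-step
  -- analysis, these are exactly the factors of φⱼ.
  Rise : Fin N → ℕ → Set
  Rise j r = mult r (next j) ≡ suc (mult r (prev j))

  rise? : ∀ j r → Dec (Rise j r)
  rise? j r = mult r (next j) ≟ suc (mult r (prev j))

  -- the range of r over which φⱼ is taken: 1, …, λ₁ for the larger partition
  scope : Fin N → List ℕ
  scope j with lookup A j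
  ... | 𝟎 = range1 (next j)
  ... | 𝟏 = range1 (prev j)

  scope-pos : ∀ j r → r ∈ scope j → 1 ≤ r
  scope-pos j r r∈ with lookup A j
  ... | 𝟎 = range1-pos (next j) r r∈
  ... | 𝟏 = range1-pos (prev j) r r∈

  mult-step-≤ : ∀ j r → 1 ≤ r → mult r (next j) ≤ suc (mult r (prev j))
  mult-step-≤ j r r≥1 with lookup A j in Aj
  ... | 𝟎 = ColumnStep-a≤1+b (columnStep _ _ r (decreasing _) (decreasing _) (strip-up j Aj) r≥1)
  ... | 𝟏 = ColumnStep-b≤1+a (columnStep _ _ r (decreasing _) (decreasing _) (strip-down j Aj) r≥1)

  ∈-scope : ∀ j r → 1 ≤ r → 1 ≤ conj (next j) r → r ∈ scope j
  ∈-scope j r r≥1 λ'≥1 with lookup A j in Aj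
  ... | 𝟎 = ∈-range1 (next j) r r≥1 λ'≥1 (decreasing _)
  ... | 𝟏 = ∈-range1 (prev j) r r≥1
    (≤-trans λ'≥1 (strip-conj-≥ _ _ r (decreasing _) (decreasing _) r≥1 (strip-down j Aj))) (decreasing _)

  -- the key of the border component starting at step j with fill r
  rise-key : Fin N → ℕ → Key
  rise-key j r = toℕ j , r , mult r (next j)

  rises-at : Fin N → List Key
  rises-at j = map (rise-key j) (filter (rise? j) (scope j))

  rises : List Key
  rises = concat (map rises-at (allFin N))

  origin-rise : ∀ {r h s b} → 1 ≤ r → (o : Origin r h s b) →
    Rise (Origin.step o) r × h ≡ mult r (next (Origin.step o))
  origin-rise {r} {h} r≥1 o = is-rise , h≡
    where
    open Origin o
    h≤m : h ≤ mult r (next step)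
    h≤m = subst (λ z → h ≤ mult z (next step)) filled (level-≤-mult box level)
    h≡ : h ≡ mult r (next step)
    h≡ = ℕP.≤-antisym h≤m (≤-trans (mult-step-≤ step r r≥1) fresh)
    is-rise : Rise step r
    is-rise = ℕP.≤-antisym (mult-step-≤ step r r≥1) (≤-trans fresh h≤m)

  key-∈-rises : ∀ {b h} → IsBox b → Level b h → key-at b h ∈ rises
  key-∈-rises {i , k} {h} bx lv = subst (_∈ rises) key≡ (∈-concat⁺′ in-step (∈-map⁺ rises-at (∈-allFin step)))
    where
    r = fill (i , k)
    r≥1 = box-fill-pos bx
    o = origin bx lv
    open Origin o
    λ'≥1 : 1 ≤ conj (next step) r
    λ'≥1 = ≤-trans (proj₁ box) (subst (λ z → row ≤ conj (next step) z) filled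
             (Band.k≤bottom (fsuc step) (fill (fsuc step , row)) (box-fill-pos box) row box refl))
    in-step : rise-key step r ∈ rises-at step
    in-step = ∈-map⁺ (rise-key step) (∈-filter⁺ (rise? step) (∈-scope step r r≥1 λ'≥1) (proj₁ (origin-rise r≥1 o)))
    key≡ : rise-key step r ≡ key-at (i , k) h
    key≡ = cong₂ _,_ starts (cong (r ,_) (sym (proj₂ (origin-rise r≥1 o))))

  -- Conversely every rise is a key: that of the top box of the r-band of
  -- λʲ⁺¹, whose level is m_r(λʲ⁺¹).
  rise-box : ∀ j r → 1 ≤ r → Rise j r →
    Σ ℕ λ k → IsBox (fsuc j , k) × Level (fsuc j , k) (mult r (next j)) ×
              key-at (fsuc j , k) (mult r (next j)) ≡ rise-key j r
  rise-box j r r≥1 is-rise = suc top , box , level , key≡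
    where
    open Band (fsuc j) r r≥1 using (top; bottom; band-box; level-intro)
    m = mult r (next j)
    bottom≡ : bottom ≡ m + top
    bottom≡ = conj-mult (next j) r
    top<bottom : suc top ≤ bottom
    top<bottom = ≤-trans (s≤s (ℕP.m≤n+m top (mult r (prev j))))
                         (≤-reflexive (sym (trans bottom≡ (cong (_+ top) is-rise))))
    box = proj₁ (band-box (suc top) ≤-refl top<bottom)
    filled = proj₂ (band-box (suc top) ≤-refl top<bottom)
    level : Level (fsuc j , suc top) m
    level = level-intro (suc top) box filled m (cong suc (trans (+-comm top m) (sym bottom≡)))
    fresh : ¬ m ≤ mult r (column (toℕ j))
    fresh m≤ = <-irrefl refl (≤-trans (≤-reflexive (sym is-rise))
                 (≤-trans m≤ (≤-reflexive (cong (mult r) (column-prev j)))))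
    key≡ : key-at (fsuc j , suc top) m ≡ rise-key j r
    key≡ = trans (cong (λ z → start z m (suc (toℕ j)) , z , m) filled)
                 (cong (λ c → c , r , m) (start-stop r m (toℕ j) fresh))

  -- Boxes with equal keys lie in the same border component: both walk to
  -- the same origin column, and there the level fixes the row.
  same-key⇒same-border : ∀ {b b' h h'} → IsBox b → Level b h → IsBox b' → Level b' h' →
    key-at b h ≡ key-at b' h' → SameBorder b b'
  same-key⇒same-border {i , k} {i' , k'} {h} {h'} bx lv bx' lv' same =
    O.reach ◅◅ subst₂ (λ s w → SameBorder (fsuc O.step , O.row) (fsuc s , w)) steps≡ rows≡ ε ◅◅ SameBorder-sym O'.reach
    where
    module O  = Origin (origin bx lv)
    module O' = Origin (origin bx' lv')
    r≡ : fill (i , k) ≡ fill (i' , k')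
    r≡ = cong (λ key → proj₁ (proj₂ key)) same
    h≡ : h ≡ h'
    h≡ = cong (λ key → proj₂ (proj₂ key)) same
    steps≡ : O.step ≡ O'.step
    steps≡ = FinP.toℕ-injective (trans O.starts (trans (cong proj₁ same) (sym O'.starts)))
    rows≡ : O.row ≡ O'.row
    rows≡ = ℕP.+-cancelʳ-≡ h _ _ (begin
      O.row + h                                        ≡⟨ level-form O.box O.level ⟩
      suc (conj (next O.step) (fill (fsuc O.step , O.row))) ≡⟨ cong (λ z → suc (conj (next O.step) z)) O.filled ⟩
      suc (conj (next O.step) (fill (i , k)))          ≡⟨ cong₂ (λ s z → suc (conj (next s) z)) steps≡ r≡ ⟩
      suc (conj (next O'.step) (fill (i' , k')))       ≡⟨ cong (λ z → suc (conj (next O'.step) z)) (sym O'.filled) ⟩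
      suc (conj (next O'.step) (fill (fsuc O'.step , O'.row))) ≡⟨ sym (level-form O'.box O'.level) ⟩
      O'.row + h'                                      ≡⟨ cong (O'.row +_) (sym h≡) ⟩
      O'.row + h                                       ∎)
      where open ≡-Reasoning

  scope-unique : ∀ j → Unique (scope j)
  scope-unique j with lookup A j
  ... | 𝟎 = Unique.map⁺ ℕP.suc-injective (Unique.upTo⁺ _)
  ... | 𝟏 = Unique.map⁺ ℕP.suc-injective (Unique.upTo⁺ _)

  rises-unique : Unique rises
  rises-unique = Unique.concat⁺ (All.map⁺ (All.tabulate (λ {j} _ → rises-at-unique j)))
                                (AllPairs.map⁺ (AllPairs.map disjoint (Unique.allFin⁺ N)))
    where
    rises-at-unique : ∀ j → Unique (rises-at j)
    rises-at-unique j = Unique.map⁺ (cong (λ key → proj₁ (proj₂ key))) (Unique.filter⁺ (rise? j) (scope-unique j))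
    disjoint : ∀ {j j'} → j ≢ j' → Disjoint (rises-at j) (rises-at j')
    disjoint j≢j' (e∈ , e∈') with ∈-map⁻ (rise-key _) e∈ | ∈-map⁻ (rise-key _) e∈'
    ... | _ , _ , refl | _ , _ , same = j≢j' (FinP.toℕ-injective (cong proj₁ same))

  module Transversal (reps : List Rep) (transversal : IsBorderTransversal reps) where

    Valid : Rep → Set
    Valid (b , h) = IsBox b × Level b h

    valid : All Valid reps
    valid = proj₁ transversal

    all-pairs : ∀ {P : Rep → Set} {xs} → All P xs → AllPairs (λ x y → P x × P y) xs
    all-pairs []         = []
    all-pairs (px ∷ pxs) = All.map (px ,_) pxs ∷ all-pairs pxs

    keys-unique : Unique (map key reps)
    keys-unique = AllPairs.map⁺ (AllPairs.zipWith
      (λ { (((bx , lv) , (bx' , lv')) , apart) same → apart (same-key⇒same-border bx lv bx' lv' same) })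
      (all-pairs valid , proj₂ (proj₂ transversal)))

    -- every rise is the key of the representative of the component of its box
    rise-∈-keys : ∀ {e} → e ∈ rises → e ∈ map key reps
    rise-∈-keys e∈ with ∈-concat⁻′ (map rises-at (allFin N)) e∈
    ... | _ , e∈at , at∈ with ∈-map⁻ rises-at at∈
    ... | j , _ , refl with ∈-map⁻ (rise-key j) e∈at
    ... | r , r∈ , refl with ∈-filter⁻ (rise? j) r∈
    ... | r∈scope , is-rise with rise-box j r (scope-pos j r r∈scope) is-rise
    ... | k , bx , lv , key≡ with find (proj₁ (proj₂ transversal) (fsuc j , k) bx)
    ... | x , x∈ , border = subst (_∈ map key reps) (trans same key≡) (∈-map⁺ key x∈)
      where
      same : key x ≡ key-at (fsuc j , k) (mult r (next j))
      same = key-border border (proj₁ (All.lookup valid x∈)) (proj₂ (All.lookup valid x∈)) lv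

    keys-↭-rises : map key reps ↭ rises
    keys-↭-rises = ∼bag⇒↭ (unique∧set⇒bag keys-unique rises-unique (mk⇔ key∈ rise-∈-keys))
      where
      key∈ : ∀ {e} → e ∈ map key reps → e ∈ rises
      key∈ e∈ with ∈-map⁻ key e∈
      ... | x , x∈ , refl = key-∈-rises (proj₁ (All.lookup valid x∈)) (proj₂ (All.lookup valid x∈))

  key-factor : Key → Poly
  key-factor (_ , _ , h) = oneMinusTPow h

  φ-as-rises : ∀ j → phiAt j ≋ prodₚ (map key-factor (rises-at j))
  φ-as-rises j with lookup A j in Aj
  ... | 𝟎 = ≋-trans
    (prod-if (rise? j) _ (λ r → oneMinusTPow (mult r (next j))) (range1 (next j))
      (All.tabulate λ {r} r∈ → cong (λ b → if b then oneMinusTPow (mult r (next j)) else oneₚ)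
        (I-condition (columnStep _ _ r (decreasing _) (decreasing _) (strip-up j Aj) (range1-pos (next j) r r∈)))))
    (≡⇒≋ (cong prodₚ (map-∘ (filter (rise? j) (range1 (next j))))))
  ... | 𝟏 = ≋-trans
    (prod-if (rise? j) _ (λ r → oneMinusTPow (mult r (next j))) (range1 (prev j))
      (All.tabulate λ {r} r∈ → cong (λ b → if b then oneMinusTPow (mult r (next j)) else oneₚ)
        (J-condition (columnStep _ _ r (decreasing _) (decreasing _) (strip-down j Aj) (range1-pos (prev j) r r∈)))))
    (≡⇒≋ (cong prodₚ (map-∘ (filter (rise? j) (range1 (prev j))))))

  Φ-as-rises : Φ ≋ prodₚ (map key-factor rises)
  Φ-as-rises = begin
    prodₚ (map phiAt (allFin N))
      ≈⟨ prod-pointwise φ-as-rises (allFin N) ⟩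
    prodₚ (map (prodₚ ∘ factors) (allFin N))
      ≡⟨ cong prodₚ (map-∘ (allFin N)) ⟩
    prodₚ (map prodₚ (map factors (allFin N)))
      ≈⟨ ≋-sym (prod-concat (map factors (allFin N))) ⟩
    prodₚ (concat (map factors (allFin N)))
      ≡⟨ cong (λ xss → prodₚ (concat xss)) (map-∘ (allFin N)) ⟩
    prodₚ (concat (map (map key-factor) (map rises-at (allFin N))))
      ≡⟨ cong prodₚ (concat-map (map rises-at (allFin N))) ⟩
    prodₚ (map key-factor rises) ∎
    where
    open SetoidReasoning ≋-setoid
    factors : Fin N → List Poly
    factors j = map key-factor (rises-at j)

  Φ≈A : (reps : List Rep) → IsBorderTransversal reps → Φ ≈ₚ Aₜ reps
  Φ≈A reps transversal = get (begin
    Φ                                       ≈⟨ Φ-as-rises ⟩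
    prodₚ (map key-factor rises)            ≈⟨ prod-↭ (↭-map⁺ key-factor (↭-sym keys-↭-rises)) ⟩
    prodₚ (map key-factor (map key reps))   ≡⟨ cong prodₚ (sym (map-∘ reps)) ⟩
    Aₜ reps                                 ∎)
    where
    open SetoidReasoning ≋-setoid
    open Transversal reps transversal using (keys-↭-rises)

-- A skew plane partition starts from λ⁰ = ∅, which is all the argument uses.
corollary2 : (T : ℕ) → 1 ≤ T →
    (ls : Vec (List ℕ) (suc (suc T))) → (A : Vec Bit (suc T)) →
    Seq.Interlacing ls A →
    lookup ls zero ≡ [] → lookup ls (fromℕ (suc T)) ≡ [] →
    lookup A zero ≡ 𝟎 → lookup A (fromℕ T) ≡ 𝟏 →
    (reps : List (Seq.Rep ls A)) → Seq.IsBorderTransversal ls A reps →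
    Seq.Φ ls A ≈ₚ Seq.Aₜ ls A reps
corollary2 T _ ls A interlacing λ⁰≡∅ _ _ _ reps transversal =
  Diagram.Φ≈A ls A interlacing λ⁰≡∅ reps transversal
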